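{- Let a graph $G$ be factored into graphs $H$ and $K$, and let $u,v$ be vertices with $\deg_H(u)=\deg_H(v)=1$ and $u$ adjacent to $v$ in $H$. For a vertex $s$ let $C_K(s)$ denote the vertex set of the connected component of $K$ containing $s$, and for $x\in C_K(u)\cup C_K(v)$ let $\varphi(x)$ be the unique neighbor of $x$ in $H$. Then $C_K(u)=\varphi(C_K(v))$ and $\varphi(C_K(u))=C_K(v)$.
   Context: All graphs are finite, simple and undirected, and $G$ has no isolated vertices. For graphs $H,K$ on the vertex set $V(G)$, $G$ is factored into $H$ and $K$ if $A=BC$, where $A,B,C$ are the adjacency matrices of $G,H,K$ with respect to one common ordering of the vertices. (Each vertex of $C_K(u)\cup C_K(v)$ has exactly one neighbor in $H$, so $\varphi$ is well defined.) -}

module Defs where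

open import Data.Nat using (ℕ; zero; suc; _+_; _*_)
open import Data.Fin using (Fin; zero; suc)
open import Data.Bool using (Bool; true; false)
open import Data.Product using (Σ; ∃; _×_)
open import Relation.Binary.PropositionalEquality using (_≡_)
open import Relation.Nullary using (¬_)
open import Relation.Binary.Construct.Closure.ReflexiveTransitive using (Star)

sumFin : (n : ℕ) → (Fin n → ℕ) → ℕ
sumFin zero    f = 0
sumFin (suc n) f = f zero + sumFin n (λ i → f (suc i))

record Graph (n : ℕ) : Set where
  field
    adj       : Fin n → Fin n → Bool
    symmetric : ∀ x y → adj x y ≡ adj y x
    irreflexive : ∀ x → adj x x ≡ false
open Graph public

Adj : {n : ℕ} → Graph n → Fin n → Fin n → Set
Adj G x y = adj G x y ≡ true

b2n : Bool → ℕ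
b2n true  = 1
b2n false = 0

adjMat : {n : ℕ} → Graph n → Fin n → Fin n → ℕ
adjMat G x y = b2n (adj G x y)

deg : {n : ℕ} → Graph n → Fin n → ℕ
deg {n} G x = sumFin n (adjMat G x)

NoIsolated : {n : ℕ} → Graph n → Set
NoIsolated G = ∀ x → ∃ λ y → Adj G x y

FactoredInto : {n : ℕ} → Graph n → Graph n → Graph n → Set
FactoredInto {n} G H K =
  ∀ x y → adjMat G x y ≡ sumFin n (λ z → adjMat H x z * adjMat K z y)

InComp : {n : ℕ} → Graph n → Fin n → Fin n → Set
InComp K s t = Star (Adj K) s t

UniqueNeighbour : {n : ℕ} → Graph n → Fin n → Set
UniqueNeighbour H x = ∃ λ y → Adj H x y × (∀ z → Adj H x z → z ≡ y)

-- Call x and y matched in H when each is the other's only H-neighbour. Since the entries of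
-- A = BC are 0/1, every G-edge x t has exactly one H-then-K path x –H– y –K– t. If x, y are
-- matched and x x' is a K-edge, then y –H– x –K– x' is such a path, so by symmetry of G there
-- is a path x' –H– z –K– y, and uniqueness of the middle vertex makes z the only H-neighbour
-- of x'. Hence matching propagates along K-edges, carrying C_K(u) onto C_K(v) and back,
-- starting from the pair u, v, which is matched because both have H-degree one.
module Submission where

open import Defs
open import Data.Nat using (ℕ; suc; _+_; _*_; _≤_; z≤n)
open import Data.Nat.Properties using (≤-refl; ≤-trans; m≤m+n; m≤n+m; +-monoʳ-≤; +-mono-≤; +-comm; <-irrefl)
open import Data.Fin using (Fin; zero; suc; _≟_)
open import Data.Bool using (true; false)
open import Data.Empty using (⊥-elim)
open import Data.Product using (∃; _×_; _,_; proj₁)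
open import Data.Sum using (_⊎_; inj₁; inj₂)
open import Relation.Nullary using (¬_; yes; no)
open import Relation.Binary.PropositionalEquality using (_≡_; refl; sym; trans; cong; subst)
open import Relation.Binary.Construct.Closure.ReflexiveTransitive using (ε; _◅_)
open import Function.Bundles using (_⇔_; mk⇔)
import Function.Properties.Equivalence as ⇔

sumFin-term : ∀ n (f : Fin n → ℕ) a → f a ≤ sumFin n f
sumFin-term (suc n) f zero    = m≤m+n (f zero) _
sumFin-term (suc n) f (suc a) = ≤-trans (sumFin-term n (λ i → f (suc i)) a) (m≤n+m _ (f zero))

sumFin-twoTerms : ∀ n (f : Fin n → ℕ) a b → ¬ a ≡ b → f a + f b ≤ sumFin n f
sumFin-twoTerms (suc n) f zero    zero    a≢b = ⊥-elim (a≢b refl)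
sumFin-twoTerms (suc n) f zero    (suc b) _   = +-monoʳ-≤ (f zero) (sumFin-term n (λ i → f (suc i)) b)
sumFin-twoTerms (suc n) f (suc a) zero    _   =
  subst (_≤ sumFin (suc n) f) (+-comm (f zero) (f (suc a)))
    (+-monoʳ-≤ (f zero) (sumFin-term n (λ i → f (suc i)) a))
sumFin-twoTerms (suc n) f (suc a) (suc b) a≢b =
  ≤-trans (sumFin-twoTerms n (λ i → f (suc i)) a b (λ a≡b → a≢b (cong suc a≡b))) (m≤n+m _ (f zero))

sumFin-positive : ∀ n (f : Fin n → ℕ) → 1 ≤ sumFin n f → ∃ λ i → 1 ≤ f i
sumFin-positive (suc n) f 1≤sum with f zero in f0≡
... | suc _ = zero , subst (1 ≤_) (sym f0≡) (m≤m+n 1 _)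
... | 0 with sumFin-positive n (λ i → f (suc i)) 1≤sum
...   | i , 1≤fi = suc i , 1≤fi

sumFin≤1-unique : ∀ n (f : Fin n → ℕ) {a b} → sumFin n f ≤ 1 → 1 ≤ f a → 1 ≤ f b → a ≡ b
sumFin≤1-unique n f {a} {b} sum≤1 1≤fa 1≤fb with a ≟ b
... | yes a≡b = a≡b
... | no  a≢b = ⊥-elim (<-irrefl refl
      (≤-trans (+-mono-≤ 1≤fa 1≤fb) (≤-trans (sumFin-twoTerms n f a b a≢b) sum≤1)))

b2n≤1 : ∀ b → b2n b ≤ 1
b2n≤1 true  = ≤-refl
b2n≤1 false = z≤n

b2n-positive : ∀ {b} → 1 ≤ b2n b → b ≡ true
b2n-positive {true} _ = refl

b2n-true : ∀ {b} → b ≡ true → 1 ≤ b2n b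
b2n-true refl = ≤-refl

b2n-*-positive : ∀ a b → 1 ≤ b2n a * b2n b → a ≡ true × b ≡ true
b2n-*-positive true true _ = refl , refl

b2n-*-true : ∀ {a b} → a ≡ true → b ≡ true → 1 ≤ b2n a * b2n b
b2n-*-true refl refl = ≤-refl

Adj-sym : ∀ {n} (X : Graph n) {x y} → Adj X x y → Adj X y x
Adj-sym X {x} {y} xy = trans (symmetric X y x) xy

OnlyNeighbour : ∀ {n} → Graph n → Fin n → Fin n → Set
OnlyNeighbour H x y = Adj H x y × (∀ z → Adj H x z → z ≡ y)

Matched : ∀ {n} → Graph n → Fin n → Fin n → Set
Matched H x y = OnlyNeighbour H x y × OnlyNeighbour H y x

Matched-sym : ∀ {n} {H : Graph n} {x y} → Matched H x y → Matched H y x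
Matched-sym (x→y , y→x) = y→x , x→y

onlyNeighbour-of-neighbour : ∀ {n} {H : Graph n} {x y z} →
  OnlyNeighbour H x y → Adj H x z → OnlyNeighbour H x z
onlyNeighbour-of-neighbour (_ , only) xz = xz , λ w xw → trans (only w xw) (sym (only _ xz))

deg≡1⇒onlyNeighbour : ∀ {n} (H : Graph n) {u v} → deg H u ≡ 1 → Adj H u v → OnlyNeighbour H u v
deg≡1⇒onlyNeighbour {n} H {u} deg≡1 uv = uv , λ w uw →
  sumFin≤1-unique n (adjMat H u) (subst (_≤ 1) (sym deg≡1) ≤-refl) (b2n-true uw) (b2n-true uv)

module Factorisation {n : ℕ} {G H K : Graph n} (factored : FactoredInto G H K) where

  path⇒Adj : ∀ {x y t} → Adj H x y → Adj K y t → Adj G x t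
  path⇒Adj {x} {y} {t} xy yt = b2n-positive (subst (1 ≤_) (sym (factored x t))
    (≤-trans (b2n-*-true xy yt) (sumFin-term n (λ z → adjMat H x z * adjMat K z t) y)))

  Adj⇒path : ∀ {x t} → Adj G x t → ∃ λ y → Adj H x y × Adj K y t
  Adj⇒path {x} {t} xt with sumFin-positive n (λ z → adjMat H x z * adjMat K z t)
                             (subst (1 ≤_) (factored x t) (b2n-true xt))
  ... | y , 1≤term = y , b2n-*-positive (adj H x y) (adj K y t) 1≤term

  path-middle-unique : ∀ {x a b t} → Adj H x a → Adj K a t → Adj H x b → Adj K b t → a ≡ b
  path-middle-unique {x} {t = t} xa at xb bt =
    sumFin≤1-unique n _ (subst (_≤ 1) (factored x t) (b2n≤1 _)) (b2n-*-true xa at) (b2n-*-true xb bt)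

  path-reverse : ∀ {x y t} → Adj H x y → Adj K y t → ∃ λ s → Adj H t s × Adj K s x
  path-reverse xy yt = Adj⇒path (Adj-sym G (path⇒Adj xy yt))

  onlyNeighbour-step : ∀ {x y x'} → OnlyNeighbour H x y → Adj K x x' →
    ∃ λ z → OnlyNeighbour H x' z × Adj K y z
  onlyNeighbour-step {x} {y} {x'} (xy , only) xx' with path-reverse (Adj-sym H xy) xx'
  ... | z , x'z , zy = z , (x'z , only-z) , Adj-sym K zy
    where
    only-z : ∀ w → Adj H x' w → w ≡ z
    only-z w x'w with path-reverse (Adj-sym H x'w) (Adj-sym K xx')
    ... | t , xt , tw = sym (path-middle-unique x'z zy x'w wy)
      where
      wy : Adj K w y
      wy = Adj-sym K (subst (λ s → Adj K s w) (only t xt) tw)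

  matched-step : ∀ {x y x'} → Matched H x y → Adj K x x' → ∃ λ z → Matched H x' z × Adj K y z
  matched-step (x→y , y→x) xx' with onlyNeighbour-step x→y xx'
  ... | z , x'→z , yz with onlyNeighbour-step y→x yz
  ...   | _ , z→x″ , _ = z , (x'→z , onlyNeighbour-of-neighbour {H = H} z→x″ (Adj-sym H (proj₁ x'→z))) , yz

  matched-along : ∀ {a b x} → Matched H a b → InComp K a x → ∃ λ y → InComp K b y × Matched H x y
  matched-along ab ε = _ , ε , ab
  matched-along ab (ax' ◅ x'x) with matched-step ab ax'
  ... | z , x'z , bz with matched-along x'z x'x
  ...   | y , zy , xy = y , bz ◅ zy , xy

  matched-component : ∀ {a b} → Matched H a b →
    ∀ x → InComp K a x ⇔ (∃ λ y → InComp K b y × Adj H y x)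
  matched-component {a} {b} ab x = mk⇔ to from
    where
    to : InComp K a x → ∃ λ y → InComp K b y × Adj H y x
    to ax with matched-along ab ax
    ... | y , by , ((xy , _) , _) = y , by , Adj-sym H xy
    from : (∃ λ y → InComp K b y × Adj H y x) → InComp K a x
    from (y , by , yx) with matched-along (Matched-sym {H = H} ab) by
    ... | _ , ay′ , ((_ , only) , _) = subst (InComp K a) (sym (only x yx)) ay′

mainTheorem6 : {n : ℕ} (G H K : Graph n) → NoIsolated G → FactoredInto G H K →
    (u v : Fin n) → deg H u ≡ 1 → deg H v ≡ 1 → Adj H u v →
    (∀ x → InComp K u x ⊎ InComp K v x → UniqueNeighbour H x)
    × (∀ x → InComp K u x ⇔ (∃ λ y → InComp K v y × Adj H y x))
    × (∀ x → (∃ λ y → InComp K u y × Adj H y x) ⇔ InComp K v x)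
mainTheorem6 G H K _ factored u v degu degv uv =
  uniqueNeighbour , matched-component uv-matched , λ x → ⇔.sym (matched-component vu-matched x)
  where
  open Factorisation {G = G} {H} {K} factored

  uv-matched : Matched H u v
  uv-matched = deg≡1⇒onlyNeighbour H degu uv , deg≡1⇒onlyNeighbour H degv (Adj-sym H uv)

  vu-matched : Matched H v u
  vu-matched = Matched-sym {H = H} uv-matched

  uniqueNeighbour : ∀ x → InComp K u x ⊎ InComp K v x → UniqueNeighbour H x
  uniqueNeighbour x (inj₁ ux) with matched-along uv-matched ux
  ... | y , _ , (x→y , _) = y , x→y
  uniqueNeighbour x (inj₂ vx) with matched-along vu-matched vx
  ... | y , _ , (x→y , _) = y , x→y
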